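{- Let $N$ be a positive integer and $T\subseteq[N]$ with $|T|\ge N/2$. Let $\phi:[N]\to[N]$ be an arbitrary mapping and let $\pi$ be a permutation of $[N]$ chosen uniformly at random. Then $\Pr\left(\exists\,\ell\in T:\ \phi(\ell)=\pi(\ell)\right)\ge\frac14$. -}

module Defs where

open import Data.Nat using (ℕ; zero; suc)
open import Data.Fin using (Fin)
open import Data.Fin.Properties using (all?; any?; _≟_)
open import Data.Fin.Subset using (Subset; _∈_)
open import Data.Fin.Subset.Properties using (_∈?_)
open import Data.Vec using (Vec; []; _∷_; lookup)
open import Data.List using (List; [_]; concatMap; map; filter; allFin)
open import Data.Product using (∃; _×_)
open import Relation.Binary.PropositionalEquality using (_≡_)
open import Relation.Nullary using (Dec)
open import Relation.Nullary.Decidable using (_→-dec_; _×-dec_)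

-- All functions Fin k → Fin n, represented as vectors of length k
-- (the i-th entry is the image of i); each function appears exactly once.
allFuns : (k n : ℕ) → List (Vec (Fin n) k)
allFuns zero    n = [ [] ]
allFuns (suc k) n = concatMap (λ v → map (_∷ v) (allFin n)) (allFuns k n)

IsPerm : ∀ {N} → Vec (Fin N) N → Set
IsPerm v = ∀ i j → lookup v i ≡ lookup v j → i ≡ j

isPerm? : ∀ {N} (v : Vec (Fin N) N) → Dec (IsPerm v)
isPerm? v = all? (λ i → all? (λ j → (lookup v i ≟ lookup v j) →-dec (i ≟ j)))

-- The list of all permutations of [N] (each exactly once): the sample space.
perms : (N : ℕ) → List (Vec (Fin N) N)
perms N = filter isPerm? (allFuns N N)

Hit : ∀ {N} → Subset N → (Fin N → Fin N) → Vec (Fin N) N → Set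
Hit T φ π = ∃ λ ℓ → ℓ ∈ T × φ ℓ ≡ lookup π ℓ

hit? : ∀ {N} (T : Subset N) (φ : Fin N → Fin N) (π : Vec (Fin N) N) → Dec (Hit T φ π)
hit? T φ π = any? (λ ℓ → (ℓ ∈? T) ×-dec (φ ℓ ≟ lookup π ℓ))

{-# OPTIONS --safe #-}
-- Let X π be the number of ℓ ∈ T with π ℓ = φ ℓ; probabilities are counts over the list perms N.
-- Relabelling values by a transposition permutes perms N, so π ℓ is uniform (E X = |T|/N ≥ 1/2)
-- and, for ℓ ≢ ℓ′ and b ≢ a, #{π ℓ = a, π ℓ′ = b} = #{π ℓ = a}/(N − 1); summing over ℓ′ gives
-- E[X · 1{π ℓ = φ ℓ}] ≤ 2 P(π ℓ = φ ℓ), hence E X² ≤ 2 E X.  As 4x ≤ x² + 4 for all x ∈ ℕ and X = 0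
-- off the event, 4 E X ≤ E X² + 4 P(X > 0) ≤ 2 E X + 4 P(X > 0), i.e. P(X > 0) ≥ E X / 2 ≥ 1/4.
module Submission where

open import Defs
open import Level using (Level)
open import Data.Nat using (ℕ; zero; suc; _+_; _*_; _∸_; _≤_; z≤n)
open import Data.Nat.Properties
  using (≤-refl; ≤-reflexive; ≤-trans; n≤1+n; m≤m+n; module ≤-Reasoning
        ; +-assoc; +-identityʳ; +-mono-≤; +-monoˡ-≤; +-cancelˡ-≤
        ; *-assoc; *-identityˡ; *-identityʳ; *-zeroʳ; *-distribˡ-+; *-distribʳ-+
        ; *-monoˡ-≤; *-monoʳ-≤; *-cancelˡ-≤
        ; +-*-semiring; +-commutativeSemigroup; *-commutativeSemigroup)
open import Data.Fin using (Fin; zero; suc; punchIn)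
open import Data.Fin.Properties using (_≟_; punchInᵢ≢i)
open import Data.Fin.Subset using (Subset; ∣_∣; inside; outside)
open import Data.Fin.Subset.Properties using (_∈?_; drop-there)
open import Data.Fin.Permutation as Perm using (Permutation; _⟨$⟩ʳ_)
import Data.Fin.Permutation.Components as PC
open import Data.Vec as Vec using (Vec; []; _∷_; lookup; there)
open import Data.Vec.Properties using (lookup-map)
open import Data.List using (List; []; _∷_; _++_; concatMap; tabulate; allFin; length; filter)
import Data.List as List
open import Data.Product using (_,_)
open import Function.Bundles using (Injection)
open import Function.Properties.Inverse using (↔⇒↣)
open import Relation.Nullary using (Dec; yes; no; ¬_; contradiction)
open import Relation.Nullary.Decidable using (dec-true; dec-false)
open import Relation.Unary using (Pred; Decidable)
open import Relation.Binary.PropositionalEquality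
open import Data.Nat.Solver using (module +-*-Solver)
open +-*-Solver using (solve; _:+_; _:*_; _:=_; con)
open import Algebra.Properties.Semiring.Sum +-*-semiring
  using ( sum; sum-syntax; sum-cong-≗; sum-remove; sum-permute; sum-replicate-zero; ∑-distrib-+
        ; *-distribˡ-sum; *-distribʳ-sum)
open import Algebra.Properties.CommutativeSemigroup +-commutativeSemigroup
  using () renaming (interchange to +-interchange)
open import Algebra.Properties.CommutativeSemigroup *-commutativeSemigroup
  using () renaming (x∙yz≈y∙xz to *-left-comm)

private variable
  r p q : Level
  A B : Set r
  P : Set p
  Q : Set q
  k n : ℕ

𝟙 : Dec P → ℕ
𝟙 (yes _) = 1
𝟙 (no _)  = 0

𝟙-yes : (d : Dec P) → P → 𝟙 d ≡ 1
𝟙-yes (yes _) _  = refl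
𝟙-yes (no ¬p) p  = contradiction p ¬p

𝟙-no : (d : Dec P) → ¬ P → 𝟙 d ≡ 0
𝟙-no (yes p) ¬p = contradiction p ¬p
𝟙-no (no _)  _  = refl

𝟙-cong : (d : Dec P) (e : Dec Q) → (P → Q) → (Q → P) → 𝟙 d ≡ 𝟙 e
𝟙-cong (yes p) e        f g = sym (𝟙-yes e (f p))
𝟙-cong (no ¬p) (yes q)  f g = contradiction (g q) ¬p
𝟙-cong (no _)  (no _)   f g = refl

𝟙≤1 : (d : Dec P) → 𝟙 d ≤ 1
𝟙≤1 (yes _) = ≤-refl
𝟙≤1 (no _)  = z≤n

infixl 10 ∑ₗ

∑ₗ : List A → (A → ℕ) → ℕ
∑ₗ []       f = 0
∑ₗ (x ∷ xs) f = f x + ∑ₗ xs f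

syntax ∑ₗ xs (λ x → e) = ∑[ x ∈ xs ] e

module _ {f g : A → ℕ} where

  ∑ₗ-cong : ∀ xs → (∀ x → f x ≡ g x) → ∑ₗ xs f ≡ ∑ₗ xs g
  ∑ₗ-cong []       _   = refl
  ∑ₗ-cong (x ∷ xs) f≗g = cong₂ _+_ (f≗g x) (∑ₗ-cong xs f≗g)

  ∑ₗ-mono-≤ : ∀ xs → (∀ x → f x ≤ g x) → ∑ₗ xs f ≤ ∑ₗ xs g
  ∑ₗ-mono-≤ []       _   = z≤n
  ∑ₗ-mono-≤ (x ∷ xs) f≤g = +-mono-≤ (f≤g x) (∑ₗ-mono-≤ xs f≤g)

  ∑ₗ-distrib-+ : ∀ xs → ∑[ x ∈ xs ] (f x + g x) ≡ ∑ₗ xs f + ∑ₗ xs g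
  ∑ₗ-distrib-+ []       = refl
  ∑ₗ-distrib-+ (x ∷ xs) =
    trans (cong (f x + g x +_) (∑ₗ-distrib-+ xs)) (+-interchange (f x) (g x) (∑ₗ xs f) (∑ₗ xs g))

*-distribˡ-∑ₗ : ∀ c xs (f : A → ℕ) → c * ∑ₗ xs f ≡ ∑[ x ∈ xs ] (c * f x)
*-distribˡ-∑ₗ c []       f = *-zeroʳ c
*-distribˡ-∑ₗ c (x ∷ xs) f = trans (*-distribˡ-+ c (f x) _) (cong (c * f x +_) (*-distribˡ-∑ₗ c xs f))

∑ₗ-const : ∀ (xs : List A) c → ∑[ x ∈ xs ] c ≡ length xs * c
∑ₗ-const []       c = refl
∑ₗ-const (x ∷ xs) c = cong (c +_) (∑ₗ-const xs c)

∑ₗ-++ : ∀ xs ys (f : A → ℕ) → ∑ₗ (xs ++ ys) f ≡ ∑ₗ xs f + ∑ₗ ys f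
∑ₗ-++ []       ys f = refl
∑ₗ-++ (x ∷ xs) ys f = trans (cong (f x +_) (∑ₗ-++ xs ys f)) (sym (+-assoc (f x) _ _))

∑ₗ-concatMap : ∀ (F : A → List B) xs f → ∑ₗ (concatMap F xs) f ≡ ∑[ x ∈ xs ] ∑ₗ (F x) f
∑ₗ-concatMap F []       f = refl
∑ₗ-concatMap F (x ∷ xs) f =
  trans (∑ₗ-++ (F x) (concatMap F xs) f) (cong (∑ₗ (F x) f +_) (∑ₗ-concatMap F xs f))

∑ₗ-map : ∀ (g : A → B) xs f → ∑ₗ (List.map g xs) f ≡ ∑[ x ∈ xs ] f (g x)
∑ₗ-map g []       f = refl
∑ₗ-map g (x ∷ xs) f = cong (f (g x) +_) (∑ₗ-map g xs f)

∑ₗ-tabulate : ∀ (g : Fin n → A) f → ∑ₗ (tabulate g) f ≡ ∑[ i < n ] f (g i)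
∑ₗ-tabulate {n = zero}  g f = refl
∑ₗ-tabulate {n = suc n} g f = cong (f (g zero) +_) (∑ₗ-tabulate (λ i → g (suc i)) f)

module _ {P : Pred A p} (P? : Decidable P) where

  ∑ₗ-filter : ∀ xs f → ∑ₗ (filter P? xs) f ≡ ∑[ x ∈ xs ] (𝟙 (P? x) * f x)
  ∑ₗ-filter []       f = refl
  ∑ₗ-filter (x ∷ xs) f with P? x
  ... | yes _ = cong₂ _+_ (sym (+-identityʳ (f x))) (∑ₗ-filter xs f)
  ... | no _  = ∑ₗ-filter xs f

  ∑ₗ-filter-cong : ∀ xs {f g} → (∀ x → P x → f x ≡ g x) → ∑ₗ (filter P? xs) f ≡ ∑ₗ (filter P? xs) g
  ∑ₗ-filter-cong []       f≗g = refl
  ∑ₗ-filter-cong (x ∷ xs) f≗g with P? x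
  ... | yes px = cong₂ _+_ (f≗g x px) (∑ₗ-filter-cong xs f≗g)
  ... | no _   = ∑ₗ-filter-cong xs f≗g

  length-filter≡∑𝟙 : ∀ xs → length (filter P? xs) ≡ ∑[ x ∈ xs ] 𝟙 (P? x)
  length-filter≡∑𝟙 xs = begin
    length (filter P? xs)              ≡⟨ *-identityʳ _ ⟨
    length (filter P? xs) * 1          ≡⟨ ∑ₗ-const (filter P? xs) 1 ⟨
    ∑[ x ∈ filter P? xs ] 1            ≡⟨ ∑ₗ-filter xs (λ _ → 1) ⟩
    ∑[ x ∈ xs ] (𝟙 (P? x) * 1)        ≡⟨ ∑ₗ-cong xs (λ x → *-identityʳ (𝟙 (P? x))) ⟩
    ∑[ x ∈ xs ] 𝟙 (P? x)              ∎
    where open ≡-Reasoning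

∑ₗ-∑-comm : ∀ (xs : List A) (f : A → Fin n → ℕ) →
            ∑[ x ∈ xs ] ∑[ i < n ] f x i ≡ ∑[ i < n ] ∑[ x ∈ xs ] f x i
∑ₗ-∑-comm {n = n} []       f = sym (sum-replicate-zero n)
∑ₗ-∑-comm         (x ∷ xs) f = trans (cong (sum (f x) +_) (∑ₗ-∑-comm xs f)) (sym (∑-distrib-+ (f x) _))

∑-const : ∀ n c → ∑[ i < n ] c ≡ n * c
∑-const zero    c = refl
∑-const (suc n) c = cong (c +_) (∑-const n c)

∑-mono-≤ : {f g : Fin n → ℕ} → (∀ i → f i ≤ g i) → sum f ≤ sum g
∑-mono-≤ {n = zero}  f≤g = z≤n
∑-mono-≤ {n = suc n} f≤g = +-mono-≤ (f≤g zero) (∑-mono-≤ (λ i → f≤g (suc i)))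

∑-𝟙-≟ : ∀ {n} (a : Fin n) → ∑[ i < n ] 𝟙 (i ≟ a) ≡ 1
∑-𝟙-≟ {suc n} a = begin
  ∑[ i < suc n ] 𝟙 (i ≟ a)
    ≡⟨ sum-remove {i = a} (λ i → 𝟙 (i ≟ a)) ⟩
  𝟙 (a ≟ a) + ∑[ j < n ] 𝟙 (punchIn a j ≟ a)
    ≡⟨ cong₂ _+_ (𝟙-yes (a ≟ a) refl) (sum-cong-≗ others) ⟩
  1 + ∑[ j < n ] 0
    ≡⟨ cong (1 +_) (sum-replicate-zero n) ⟩
  1 ∎
  where
  open ≡-Reasoning
  others : ∀ j → 𝟙 (punchIn a j ≟ a) ≡ 0
  others j = 𝟙-no (punchIn a j ≟ a) (punchInᵢ≢i a j)

n*fᵢ≤c⇒∑f≤c : ∀ {n} {f : Fin n → ℕ} c → (∀ i → n * f i ≤ c) → sum f ≤ c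
n*fᵢ≤c⇒∑f≤c {zero}  c _ = z≤n
n*fᵢ≤c⇒∑f≤c {suc n} {f} c n*f≤c = *-cancelˡ-≤ (suc n) (begin
  suc n * sum f            ≡⟨ *-distribˡ-sum (suc n) f ⟩
  ∑[ i < suc n ] (suc n * f i) ≤⟨ ∑-mono-≤ n*f≤c ⟩
  ∑[ i < suc n ] c         ≡⟨ ∑-const (suc n) c ⟩
  suc n * c                ∎)
  where open ≤-Reasoning

𝟙-∈?-suc : ∀ {x} (T : Subset n) i → 𝟙 (i ∈? T) ≡ 𝟙 (suc i ∈? (x ∷ T))
𝟙-∈?-suc T i = 𝟙-cong (i ∈? T) _ there drop-there

∣p∣≡∑𝟙∈ : (T : Subset n) → ∣ T ∣ ≡ ∑[ i < n ] 𝟙 (i ∈? T)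
∣p∣≡∑𝟙∈ []            = refl
∣p∣≡∑𝟙∈ (inside ∷ T)  = cong suc (trans (∣p∣≡∑𝟙∈ T) (sum-cong-≗ (𝟙-∈?-suc T)))
∣p∣≡∑𝟙∈ (outside ∷ T) = trans (∣p∣≡∑𝟙∈ T) (sum-cong-≗ (𝟙-∈?-suc T))

∑-allFuns-suc : ∀ (h : Vec (Fin n) (suc k) → ℕ) →
                ∑ₗ (allFuns (suc k) n) h ≡ ∑[ v ∈ allFuns k n ] ∑[ x < n ] h (x ∷ v)
∑-allFuns-suc {n} {k} h = begin
  ∑ₗ (allFuns (suc k) n) h
    ≡⟨ ∑ₗ-concatMap (λ v → List.map (_∷ v) (allFin n)) (allFuns k n) h ⟩
  ∑[ v ∈ allFuns k n ] ∑ₗ (List.map (_∷ v) (allFin n)) h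
    ≡⟨ ∑ₗ-cong (allFuns k n) row ⟩
  ∑[ v ∈ allFuns k n ] ∑[ x < n ] h (x ∷ v) ∎
  where
  open ≡-Reasoning
  row : ∀ v → ∑ₗ (List.map (_∷ v) (allFin n)) h ≡ ∑[ x < n ] h (x ∷ v)
  row v = trans (∑ₗ-map (_∷ v) (allFin n) h) (∑ₗ-tabulate (λ x → x) (λ x → h (x ∷ v)))

𝟙[_↦_] : Fin n → Fin n → Vec (Fin n) n → ℕ
𝟙[ ℓ ↦ a ] π = 𝟙 (a ≟ lookup π ℓ)

#[_↦_] : Fin n → Fin n → ℕ
#[ ℓ ↦ a ] = ∑[ π ∈ perms _ ] 𝟙[ ℓ ↦ a ] π

#[_↦_∧_↦_] : Fin n → Fin n → Fin n → Fin n → ℕ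
#[ ℓ ↦ a ∧ ℓ′ ↦ b ] = ∑[ π ∈ perms _ ] (𝟙[ ℓ ↦ a ] π * 𝟙[ ℓ′ ↦ b ] π)

module _ (τ : Permutation n n) where

  private
    τ-injective : ∀ {x y} → τ ⟨$⟩ʳ x ≡ τ ⟨$⟩ʳ y → x ≡ y
    τ-injective = Injection.injective (↔⇒↣ τ)

  ∑-allFuns-map : ∀ k (h : Vec (Fin n) k → ℕ) →
                  ∑[ v ∈ allFuns k n ] h (Vec.map (τ ⟨$⟩ʳ_) v) ≡ ∑ₗ (allFuns k n) h
  ∑-allFuns-map zero    h = refl
  ∑-allFuns-map (suc k) h = begin
    ∑[ v ∈ allFuns (suc k) n ] h (Vec.map (τ ⟨$⟩ʳ_) v)
      ≡⟨ ∑-allFuns-suc (λ v → h (Vec.map (τ ⟨$⟩ʳ_) v)) ⟩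
    ∑[ v ∈ allFuns k n ] ∑[ x < n ] h ((τ ⟨$⟩ʳ x) ∷ Vec.map (τ ⟨$⟩ʳ_) v)
      ≡⟨ ∑ₗ-cong (allFuns k n) (λ v → sum-permute _ τ) ⟨
    ∑[ v ∈ allFuns k n ] ∑[ x < n ] h (x ∷ Vec.map (τ ⟨$⟩ʳ_) v)
      ≡⟨ ∑-allFuns-map k (λ v → ∑[ x < n ] h (x ∷ v)) ⟩
    ∑[ v ∈ allFuns k n ] ∑[ x < n ] h (x ∷ v)
      ≡⟨ ∑-allFuns-suc h ⟨
    ∑ₗ (allFuns (suc k) n) h ∎
    where open ≡-Reasoning

  IsPerm-map⁺ : ∀ {v} → IsPerm v → IsPerm (Vec.map (τ ⟨$⟩ʳ_) v)
  IsPerm-map⁺ {v} v-inj i j τvᵢ≡τvⱼ = v-inj i j (τ-injective (begin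
    τ ⟨$⟩ʳ lookup v i             ≡⟨ lookup-map i (τ ⟨$⟩ʳ_) v ⟨
    lookup (Vec.map (τ ⟨$⟩ʳ_) v) i ≡⟨ τvᵢ≡τvⱼ ⟩
    lookup (Vec.map (τ ⟨$⟩ʳ_) v) j ≡⟨ lookup-map j (τ ⟨$⟩ʳ_) v ⟩
    τ ⟨$⟩ʳ lookup v j             ∎))
    where open ≡-Reasoning

  IsPerm-map⁻ : ∀ {v} → IsPerm (Vec.map (τ ⟨$⟩ʳ_) v) → IsPerm v
  IsPerm-map⁻ {v} τv-inj i j vᵢ≡vⱼ =
    τv-inj i j (trans (lookup-map i (τ ⟨$⟩ʳ_) v)
                      (trans (cong (τ ⟨$⟩ʳ_) vᵢ≡vⱼ) (sym (lookup-map j (τ ⟨$⟩ʳ_) v))))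

  ∑-perms-map : ∀ (g : Vec (Fin n) n → ℕ) →
                ∑[ π ∈ perms n ] g (Vec.map (τ ⟨$⟩ʳ_) π) ≡ ∑ₗ (perms n) g
  ∑-perms-map g = begin
    ∑[ π ∈ perms n ] g (τ∘ π)
      ≡⟨ ∑ₗ-filter isPerm? (allFuns n n) _ ⟩
    ∑[ v ∈ allFuns n n ] (𝟙 (isPerm? v) * g (τ∘ v))
      ≡⟨ ∑ₗ-cong (allFuns n n) isPerm-invariant ⟩
    ∑[ v ∈ allFuns n n ] (𝟙 (isPerm? (τ∘ v)) * g (τ∘ v))
      ≡⟨ ∑-allFuns-map n (λ v → 𝟙 (isPerm? v) * g v) ⟩
    ∑[ v ∈ allFuns n n ] (𝟙 (isPerm? v) * g v)
      ≡⟨ ∑ₗ-filter isPerm? (allFuns n n) g ⟨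
    ∑ₗ (perms n) g ∎
    where
    open ≡-Reasoning
    τ∘ : Vec (Fin n) n → Vec (Fin n) n
    τ∘ = Vec.map (τ ⟨$⟩ʳ_)
    isPerm-invariant : ∀ v → 𝟙 (isPerm? v) * g (τ∘ v) ≡ 𝟙 (isPerm? (τ∘ v)) * g (τ∘ v)
    isPerm-invariant v =
      cong (_* g (τ∘ v)) (𝟙-cong (isPerm? v) (isPerm? (τ∘ v)) (IsPerm-map⁺ {v}) (IsPerm-map⁻ {v}))

  𝟙[↦]-map : ∀ ℓ a π → 𝟙[ ℓ ↦ τ ⟨$⟩ʳ a ] (Vec.map (τ ⟨$⟩ʳ_) π) ≡ 𝟙[ ℓ ↦ a ] π
  𝟙[↦]-map ℓ a π rewrite lookup-map ℓ (τ ⟨$⟩ʳ_) π = 𝟙-cong _ _ τ-injective (cong (τ ⟨$⟩ʳ_))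

  #[↦]-map : ∀ ℓ a → #[ ℓ ↦ τ ⟨$⟩ʳ a ] ≡ #[ ℓ ↦ a ]
  #[↦]-map ℓ a = trans (sym (∑-perms-map 𝟙[ ℓ ↦ τ ⟨$⟩ʳ a ])) (∑ₗ-cong (perms n) (𝟙[↦]-map ℓ a))

  #[↦∧↦]-map : ∀ ℓ a ℓ′ b → #[ ℓ ↦ τ ⟨$⟩ʳ a ∧ ℓ′ ↦ τ ⟨$⟩ʳ b ] ≡ #[ ℓ ↦ a ∧ ℓ′ ↦ b ]
  #[↦∧↦]-map ℓ a ℓ′ b =
    trans (sym (∑-perms-map (λ π → 𝟙[ ℓ ↦ τ ⟨$⟩ʳ a ] π * 𝟙[ ℓ′ ↦ τ ⟨$⟩ʳ b ] π)))
          (∑ₗ-cong (perms n) (λ π → cong₂ _*_ (𝟙[↦]-map ℓ a π) (𝟙[↦]-map ℓ′ b π)))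

transpose-matchˡ : ∀ (i j : Fin n) → PC.transpose i j i ≡ j
transpose-matchˡ i j rewrite dec-true (i ≟ i) refl = refl

transpose-fix : ∀ {i j k : Fin n} → k ≢ i → k ≢ j → PC.transpose i j k ≡ k
transpose-fix {i = i} {j} {k} k≢i k≢j rewrite dec-false (k ≟ i) k≢i | dec-false (k ≟ j) k≢j = refl

#[↦]-indep : ∀ ℓ (a b : Fin n) → #[ ℓ ↦ a ] ≡ #[ ℓ ↦ b ]
#[↦]-indep ℓ a b =
  trans (sym (#[↦]-map (Perm.transpose a b) ℓ a)) (cong (λ c → #[ ℓ ↦ c ]) (transpose-matchˡ a b))

#[↦∧↦]-indep : ∀ {ℓ ℓ′} {a b b′ : Fin n} → a ≢ b → a ≢ b′ →
               #[ ℓ ↦ a ∧ ℓ′ ↦ b ] ≡ #[ ℓ ↦ a ∧ ℓ′ ↦ b′ ]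
#[↦∧↦]-indep {ℓ = ℓ} {ℓ′} {a} {b} {b′} a≢b a≢b′ =
  trans (sym (#[↦∧↦]-map (Perm.transpose b b′) ℓ a ℓ′ b))
        (cong₂ (λ c d → #[ ℓ ↦ c ∧ ℓ′ ↦ d ]) (transpose-fix a≢b a≢b′) (transpose-matchˡ b b′))

∑-𝟙[↦] : ∀ ℓ (π : Vec (Fin n) n) → ∑[ a < n ] 𝟙[ ℓ ↦ a ] π ≡ 1
∑-𝟙[↦] ℓ π = ∑-𝟙-≟ (lookup π ℓ)

n*#[↦]≡#perms : ∀ ℓ (a : Fin n) → n * #[ ℓ ↦ a ] ≡ length (perms n)
n*#[↦]≡#perms {n} ℓ a = begin
  n * #[ ℓ ↦ a ]                           ≡⟨ ∑-const n _ ⟨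
  ∑[ b < n ] #[ ℓ ↦ a ]                    ≡⟨ sum-cong-≗ (#[↦]-indep ℓ a) ⟩
  ∑[ b < n ] #[ ℓ ↦ b ]                    ≡⟨ ∑ₗ-∑-comm (perms n) (λ π b → 𝟙[ ℓ ↦ b ] π) ⟨
  ∑[ π ∈ perms n ] ∑[ b < n ] 𝟙[ ℓ ↦ b ] π ≡⟨ ∑ₗ-cong (perms n) (∑-𝟙[↦] ℓ) ⟩
  ∑[ π ∈ perms n ] 1                       ≡⟨ ∑ₗ-const (perms n) 1 ⟩
  length (perms n) * 1                     ≡⟨ *-identityʳ _ ⟩
  length (perms n)                         ∎
  where open ≡-Reasoning

∑-#[↦∧↦] : ∀ ℓ (a : Fin n) ℓ′ → ∑[ b < n ] #[ ℓ ↦ a ∧ ℓ′ ↦ b ] ≡ #[ ℓ ↦ a ]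
∑-#[↦∧↦] {n} ℓ a ℓ′ = begin
  ∑[ b < n ] #[ ℓ ↦ a ∧ ℓ′ ↦ b ]
    ≡⟨ ∑ₗ-∑-comm (perms n) (λ π b → 𝟙[ ℓ ↦ a ] π * 𝟙[ ℓ′ ↦ b ] π) ⟨
  ∑[ π ∈ perms n ] ∑[ b < n ] (𝟙[ ℓ ↦ a ] π * 𝟙[ ℓ′ ↦ b ] π)
    ≡⟨ ∑ₗ-cong (perms n) (λ π → *-distribˡ-sum (𝟙[ ℓ ↦ a ] π) (λ b → 𝟙[ ℓ′ ↦ b ] π)) ⟨
  ∑[ π ∈ perms n ] (𝟙[ ℓ ↦ a ] π * ∑[ b < n ] 𝟙[ ℓ′ ↦ b ] π)
    ≡⟨ ∑ₗ-cong (perms n) (λ π → cong (𝟙[ ℓ ↦ a ] π *_) (∑-𝟙[↦] ℓ′ π)) ⟩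
  ∑[ π ∈ perms n ] (𝟙[ ℓ ↦ a ] π * 1)
    ≡⟨ ∑ₗ-cong (perms n) (λ π → *-identityʳ _) ⟩
  #[ ℓ ↦ a ] ∎
  where open ≡-Reasoning

#[↦∧↦]-collision : ∀ {ℓ ℓ′ a : Fin n} → ℓ ≢ ℓ′ → #[ ℓ ↦ a ∧ ℓ′ ↦ a ] ≡ 0
#[↦∧↦]-collision {n} {ℓ} {ℓ′} {a} ℓ≢ℓ′ = begin
  #[ ℓ ↦ a ∧ ℓ′ ↦ a ]    ≡⟨ ∑ₗ-filter-cong isPerm? (allFuns n n) no-collision ⟩
  ∑[ π ∈ perms n ] 0     ≡⟨ ∑ₗ-const (perms n) 0 ⟩
  length (perms n) * 0   ≡⟨ *-zeroʳ (length (perms n)) ⟩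
  0                      ∎
  where
  open ≡-Reasoning
  no-collision : ∀ π → IsPerm π → 𝟙[ ℓ ↦ a ] π * 𝟙[ ℓ′ ↦ a ] π ≡ 0
  no-collision π π-inj with a ≟ lookup π ℓ | a ≟ lookup π ℓ′
  ... | yes a≡πℓ | yes a≡πℓ′ = contradiction (π-inj ℓ ℓ′ (trans (sym a≡πℓ) a≡πℓ′)) ℓ≢ℓ′
  ... | yes _    | no _      = refl
  ... | no _     | _         = refl

#[↦∧↦]≤#[↦] : ∀ (ℓ : Fin n) a ℓ′ b → #[ ℓ ↦ a ∧ ℓ′ ↦ b ] ≤ #[ ℓ ↦ a ]
#[↦∧↦]≤#[↦] ℓ a ℓ′ b = ∑ₗ-mono-≤ (perms _) λ π →
  ≤-trans (*-monoʳ-≤ (𝟙[ ℓ ↦ a ] π) (𝟙≤1 (b ≟ lookup π ℓ′))) (≤-reflexive (*-identityʳ _))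

n∸1*#[↦∧↦]≡#[↦] : ∀ {ℓ ℓ′ a b : Fin n} → ℓ ≢ ℓ′ → a ≢ b →
                  (n ∸ 1) * #[ ℓ ↦ a ∧ ℓ′ ↦ b ] ≡ #[ ℓ ↦ a ]
n∸1*#[↦∧↦]≡#[↦] {suc m} {ℓ} {ℓ′} {a} {b} ℓ≢ℓ′ a≢b = begin
  m * #[ ℓ ↦ a ∧ ℓ′ ↦ b ]
    ≡⟨ ∑-const m _ ⟨
  ∑[ j < m ] #[ ℓ ↦ a ∧ ℓ′ ↦ b ]
    ≡⟨ sum-cong-≗ (λ j → #[↦∧↦]-indep a≢b (λ a≡aⱼ → punchInᵢ≢i a j (sym a≡aⱼ))) ⟩
  ∑[ j < m ] #[ ℓ ↦ a ∧ ℓ′ ↦ punchIn a j ]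
    ≡⟨ cong (_+ ∑[ j < m ] #[ ℓ ↦ a ∧ ℓ′ ↦ punchIn a j ]) (#[↦∧↦]-collision {a = a} ℓ≢ℓ′) ⟨
  #[ ℓ ↦ a ∧ ℓ′ ↦ a ] + ∑[ j < m ] #[ ℓ ↦ a ∧ ℓ′ ↦ punchIn a j ]
    ≡⟨ sum-remove {i = a} (λ c → #[ ℓ ↦ a ∧ ℓ′ ↦ c ]) ⟨
  ∑[ c < suc m ] #[ ℓ ↦ a ∧ ℓ′ ↦ c ]
    ≡⟨ ∑-#[↦∧↦] ℓ a ℓ′ ⟩
  #[ ℓ ↦ a ] ∎
  where open ≡-Reasoning

n∸1*#[↦∧↦]≤#[↦] : ∀ {ℓ ℓ′ : Fin n} a b → ℓ ≢ ℓ′ →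
                  (n ∸ 1) * #[ ℓ ↦ a ∧ ℓ′ ↦ b ] ≤ #[ ℓ ↦ a ]
n∸1*#[↦∧↦]≤#[↦] {n} {ℓ} {ℓ′} a b ℓ≢ℓ′ with a ≟ b
... | yes refl = begin
  (n ∸ 1) * #[ ℓ ↦ a ∧ ℓ′ ↦ a ] ≡⟨ cong ((n ∸ 1) *_) (#[↦∧↦]-collision {a = a} ℓ≢ℓ′) ⟩
  (n ∸ 1) * 0                   ≡⟨ *-zeroʳ (n ∸ 1) ⟩
  0                             ≤⟨ z≤n ⟩
  #[ ℓ ↦ a ]                    ∎
  where open ≤-Reasoning
... | no a≢b   = ≤-reflexive (n∸1*#[↦∧↦]≡#[↦] ℓ≢ℓ′ a≢b)

∑-#[↦∧↦]≤2*#[↦] : ∀ ℓ (a : Fin n) (b : Fin n → Fin n) →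
                  ∑[ ℓ′ < n ] #[ ℓ ↦ a ∧ ℓ′ ↦ b ℓ′ ] ≤ 2 * #[ ℓ ↦ a ]
∑-#[↦∧↦]≤2*#[↦] {suc m} ℓ a b = begin
  ∑[ ℓ′ < suc m ] #[ ℓ ↦ a ∧ ℓ′ ↦ b ℓ′ ]
    ≡⟨ sum-remove {i = ℓ} (λ ℓ′ → #[ ℓ ↦ a ∧ ℓ′ ↦ b ℓ′ ]) ⟩
  #[ ℓ ↦ a ∧ ℓ ↦ b ℓ ] + ∑[ j < m ] #[ ℓ ↦ a ∧ punchIn ℓ j ↦ b (punchIn ℓ j) ]
    ≤⟨ +-mono-≤ (#[↦∧↦]≤#[↦] ℓ a ℓ (b ℓ)) others ⟩
  #[ ℓ ↦ a ] + #[ ℓ ↦ a ]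
    ≡⟨ cong (#[ ℓ ↦ a ] +_) (+-identityʳ _) ⟨
  2 * #[ ℓ ↦ a ] ∎
  where
  open ≤-Reasoning
  others : ∑[ j < m ] #[ ℓ ↦ a ∧ punchIn ℓ j ↦ b (punchIn ℓ j) ] ≤ #[ ℓ ↦ a ]
  others = n*fᵢ≤c⇒∑f≤c _ λ j →
    n∸1*#[↦∧↦]≤#[↦] a (b (punchIn ℓ j)) (λ ℓ≡ℓⱼ → punchInᵢ≢i ℓ j (sym ℓ≡ℓⱼ))

4*n≤n*n+4 : ∀ n → 4 * n ≤ n * n + 4
4*n≤n*n+4 0               = z≤n
4*n≤n*n+4 1               = n≤1+n 4
4*n≤n*n+4 n@(suc (suc m)) = begin
  4 * n
    ≡⟨ solve 1 (λ m → con 4 :* (con 2 :+ m) := con 8 :+ con 4 :* m) refl m ⟩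
  8 + 4 * m
    ≤⟨ m≤m+n (8 + 4 * m) (m * m) ⟩
  8 + 4 * m + m * m
    ≡⟨ solve 1 (λ m → con 8 :+ con 4 :* m :+ m :* m := (con 2 :+ m) :* (con 2 :+ m) :+ con 4) refl m ⟩
  n * n + 4 ∎
  where open ≤-Reasoning

module _ {P : Pred A p} (P? : Decidable P) (X : A → ℕ) (X-vanishes : ∀ x → ¬ P x → X x ≡ 0) where

  ∑²≤2∑⇒∑≤2*#filter : ∀ xs → ∑[ x ∈ xs ] (X x * X x) ≤ 2 * ∑ₗ xs X →
                      ∑ₗ xs X ≤ 2 * length (filter P? xs)
  ∑²≤2∑⇒∑≤2*#filter xs second-moment = *-cancelˡ-≤ 2 (+-cancelˡ-≤ (2 * S) _ _ (begin
    2 * S + 2 * S                                        ≡⟨ *-distribʳ-+ S 2 2 ⟨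
    4 * S                                                ≡⟨ *-distribˡ-∑ₗ 4 xs X ⟩
    ∑[ x ∈ xs ] (4 * X x)                                ≤⟨ ∑ₗ-mono-≤ xs pointwise ⟩
    ∑[ x ∈ xs ] (X x * X x + 4 * 𝟙 (P? x))               ≡⟨ ∑ₗ-distrib-+ xs ⟩
    ∑[ x ∈ xs ] (X x * X x) + ∑[ x ∈ xs ] (4 * 𝟙 (P? x)) ≡⟨ cong (_ +_) count ⟩
    ∑[ x ∈ xs ] (X x * X x) + 4 * H                      ≤⟨ +-monoˡ-≤ (4 * H) second-moment ⟩
    2 * S + 4 * H                                        ≡⟨ cong (2 * S +_) (*-assoc 2 2 H) ⟩
    2 * S + 2 * (2 * H)                                  ∎))
    where
    open ≤-Reasoning
    S = ∑ₗ xs X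
    H = length (filter P? xs)
    pointwise : ∀ x → 4 * X x ≤ X x * X x + 4 * 𝟙 (P? x)
    pointwise x with P? x
    ... | yes _ = 4*n≤n*n+4 (X x)
    ... | no ¬px rewrite X-vanishes x ¬px = z≤n
    count : ∑[ x ∈ xs ] (4 * 𝟙 (P? x)) ≡ 4 * H
    count = trans (sym (*-distribˡ-∑ₗ 4 xs (λ x → 𝟙 (P? x))))
                  (cong (4 *_) (sym (length-filter≡∑𝟙 P? xs)))

module _ {N : ℕ} (T : Subset N) (φ : Fin N → Fin N) where

  agreesAt : Fin N → Vec (Fin N) N → ℕ
  agreesAt ℓ π = 𝟙 (ℓ ∈? T) * 𝟙[ ℓ ↦ φ ℓ ] π

  agreements : Vec (Fin N) N → ℕ
  agreements π = ∑[ ℓ < N ] agreesAt ℓ π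

  agreements-vanish : ∀ π → ¬ Hit T φ π → agreements π ≡ 0
  agreements-vanish π no-hit = trans (sum-cong-≗ agreesAt≡0) (sum-replicate-zero N)
    where
    agreesAt≡0 : ∀ ℓ → agreesAt ℓ π ≡ 0
    agreesAt≡0 ℓ with ℓ ∈? T | φ ℓ ≟ lookup π ℓ
    ... | yes ℓ∈T | yes φℓ≡πℓ = contradiction (ℓ , ℓ∈T , φℓ≡πℓ) no-hit
    ... | yes _   | no _      = refl
    ... | no _    | _         = refl

  ∑-agreements : ∑ₗ (perms N) agreements ≡ ∑[ ℓ < N ] (𝟙 (ℓ ∈? T) * #[ ℓ ↦ φ ℓ ])
  ∑-agreements = trans (∑ₗ-∑-comm (perms N) (λ π ℓ → agreesAt ℓ π))
                       (sum-cong-≗ (λ ℓ → sym (*-distribˡ-∑ₗ (𝟙 (ℓ ∈? T)) (perms N) 𝟙[ ℓ ↦ φ ℓ ])))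

  N*∑agreements≡∣T∣*#perms : N * ∑ₗ (perms N) agreements ≡ ∣ T ∣ * length (perms N)
  N*∑agreements≡∣T∣*#perms = begin
    N * ∑ₗ (perms N) agreements
      ≡⟨ cong (N *_) ∑-agreements ⟩
    N * ∑[ ℓ < N ] (𝟙 (ℓ ∈? T) * #[ ℓ ↦ φ ℓ ])
      ≡⟨ *-distribˡ-sum N (λ ℓ → 𝟙 (ℓ ∈? T) * #[ ℓ ↦ φ ℓ ]) ⟩
    ∑[ ℓ < N ] (N * (𝟙 (ℓ ∈? T) * #[ ℓ ↦ φ ℓ ]))
      ≡⟨ sum-cong-≗ uniform ⟩
    ∑[ ℓ < N ] (𝟙 (ℓ ∈? T) * length (perms N))
      ≡⟨ *-distribʳ-sum (length (perms N)) (λ ℓ → 𝟙 (ℓ ∈? T)) ⟨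
    ∑[ ℓ < N ] 𝟙 (ℓ ∈? T) * length (perms N)
      ≡⟨ cong (_* length (perms N)) (∣p∣≡∑𝟙∈ T) ⟨
    ∣ T ∣ * length (perms N) ∎
    where
    open ≡-Reasoning
    uniform : ∀ ℓ → N * (𝟙 (ℓ ∈? T) * #[ ℓ ↦ φ ℓ ]) ≡ 𝟙 (ℓ ∈? T) * length (perms N)
    uniform ℓ =
      trans (*-left-comm N (𝟙 (ℓ ∈? T)) _) (cong (𝟙 (ℓ ∈? T) *_) (n*#[↦]≡#perms ℓ (φ ℓ)))

  ∑-𝟙[↦]*agreements≤2*#[↦] : ∀ ℓ a →
    ∑[ π ∈ perms N ] (𝟙[ ℓ ↦ a ] π * agreements π) ≤ 2 * #[ ℓ ↦ a ]
  ∑-𝟙[↦]*agreements≤2*#[↦] ℓ a = begin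
    ∑[ π ∈ perms N ] (𝟙[ ℓ ↦ a ] π * agreements π)
      ≡⟨ ∑ₗ-cong (perms N) (λ π → *-distribˡ-sum (𝟙[ ℓ ↦ a ] π) (λ ℓ′ → agreesAt ℓ′ π)) ⟩
    ∑[ π ∈ perms N ] ∑[ ℓ′ < N ] (𝟙[ ℓ ↦ a ] π * agreesAt ℓ′ π)
      ≤⟨ ∑ₗ-mono-≤ (perms N) (λ π → ∑-mono-≤ (λ ℓ′ → *-monoʳ-≤ (𝟙[ ℓ ↦ a ] π) (agreesAt≤𝟙 ℓ′ π))) ⟩
    ∑[ π ∈ perms N ] ∑[ ℓ′ < N ] (𝟙[ ℓ ↦ a ] π * 𝟙[ ℓ′ ↦ φ ℓ′ ] π)
      ≡⟨ ∑ₗ-∑-comm (perms N) (λ π ℓ′ → 𝟙[ ℓ ↦ a ] π * 𝟙[ ℓ′ ↦ φ ℓ′ ] π) ⟩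
    ∑[ ℓ′ < N ] #[ ℓ ↦ a ∧ ℓ′ ↦ φ ℓ′ ]
      ≤⟨ ∑-#[↦∧↦]≤2*#[↦] ℓ a φ ⟩
    2 * #[ ℓ ↦ a ] ∎
    where
    open ≤-Reasoning
    agreesAt≤𝟙 : ∀ ℓ′ π → agreesAt ℓ′ π ≤ 𝟙[ ℓ′ ↦ φ ℓ′ ] π
    agreesAt≤𝟙 ℓ′ π =
      ≤-trans (*-monoˡ-≤ (𝟙[ ℓ′ ↦ φ ℓ′ ] π) (𝟙≤1 (ℓ′ ∈? T))) (≤-reflexive (*-identityˡ _))

  ∑agreements²≤2*∑agreements :
    ∑[ π ∈ perms N ] (agreements π * agreements π) ≤ 2 * ∑ₗ (perms N) agreements
  ∑agreements²≤2*∑agreements = begin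
    ∑[ π ∈ perms N ] (agreements π * agreements π)
      ≡⟨ ∑ₗ-cong (perms N) (λ π → *-distribʳ-sum (agreements π) (λ ℓ → agreesAt ℓ π)) ⟩
    ∑[ π ∈ perms N ] ∑[ ℓ < N ] (agreesAt ℓ π * agreements π)
      ≡⟨ ∑ₗ-∑-comm (perms N) (λ π ℓ → agreesAt ℓ π * agreements π) ⟩
    ∑[ ℓ < N ] ∑[ π ∈ perms N ] (agreesAt ℓ π * agreements π)
      ≡⟨ sum-cong-≗ (λ ℓ → sym (pull-𝟙∈ ℓ)) ⟩
    ∑[ ℓ < N ] (𝟙 (ℓ ∈? T) * ∑[ π ∈ perms N ] (𝟙[ ℓ ↦ φ ℓ ] π * agreements π))
      ≤⟨ ∑-mono-≤ (λ ℓ → *-monoʳ-≤ (𝟙 (ℓ ∈? T)) (∑-𝟙[↦]*agreements≤2*#[↦] ℓ (φ ℓ))) ⟩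
    ∑[ ℓ < N ] (𝟙 (ℓ ∈? T) * (2 * #[ ℓ ↦ φ ℓ ]))
      ≡⟨ sum-cong-≗ (λ ℓ → *-left-comm (𝟙 (ℓ ∈? T)) 2 _) ⟩
    ∑[ ℓ < N ] (2 * (𝟙 (ℓ ∈? T) * #[ ℓ ↦ φ ℓ ]))
      ≡⟨ *-distribˡ-sum 2 (λ ℓ → 𝟙 (ℓ ∈? T) * #[ ℓ ↦ φ ℓ ]) ⟨
    2 * ∑[ ℓ < N ] (𝟙 (ℓ ∈? T) * #[ ℓ ↦ φ ℓ ])
      ≡⟨ cong (2 *_) ∑-agreements ⟨
    2 * ∑ₗ (perms N) agreements ∎
    where
    open ≤-Reasoning
    pull-𝟙∈ : ∀ ℓ → 𝟙 (ℓ ∈? T) * ∑[ π ∈ perms N ] (𝟙[ ℓ ↦ φ ℓ ] π * agreements π)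
                    ≡ ∑[ π ∈ perms N ] (agreesAt ℓ π * agreements π)
    pull-𝟙∈ ℓ = trans (*-distribˡ-∑ₗ (𝟙 (ℓ ∈? T)) (perms N) _)
                      (∑ₗ-cong (perms N) (λ π → sym (*-assoc (𝟙 (ℓ ∈? T)) _ _)))

mainTheorem10 : (N : ℕ) → 1 ≤ N → (T : Subset N) → N ≤ 2 * ∣ T ∣ → (φ : Fin N → Fin N)
    → length (perms N) ≤ 4 * length (filter (hit? T φ) (perms N))
mainTheorem10 N@(suc _) _ T N≤2∣T∣ φ = *-cancelˡ-≤ N (begin
  N * #perms               ≤⟨ *-monoˡ-≤ #perms N≤2∣T∣ ⟩
  2 * ∣ T ∣ * #perms       ≡⟨ *-assoc 2 ∣ T ∣ #perms ⟩
  2 * (∣ T ∣ * #perms)     ≡⟨ cong (2 *_) (N*∑agreements≡∣T∣*#perms T φ) ⟨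
  2 * (N * #agreements)    ≡⟨ *-left-comm 2 N #agreements ⟩
  N * (2 * #agreements)    ≤⟨ *-monoʳ-≤ N (*-monoʳ-≤ 2 #agreements≤2*#hits) ⟩
  N * (2 * (2 * #hits))    ≡⟨ cong (N *_) (*-assoc 2 2 #hits) ⟨
  N * (4 * #hits)          ∎)
  where
  open ≤-Reasoning
  #perms = length (perms N)
  #hits = length (filter (hit? T φ) (perms N))
  #agreements = ∑ₗ (perms N) (agreements T φ)
  #agreements≤2*#hits : #agreements ≤ 2 * #hits
  #agreements≤2*#hits = ∑²≤2∑⇒∑≤2*#filter (hit? T φ) (agreements T φ) (agreements-vanish T φ)
                                           (perms N) (∑agreements²≤2*∑agreements T φ)
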